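{- Let $G=(V,E,w)$ be a vertex-weighted directed graph and let $G'$ be the undirected graph with vertex set $V_{\mathrm{out}}\cup V_{\mathrm{in}}$ (two disjoint copies $\{v_{\mathrm{out}}:v\in V\}$ and $\{v_{\mathrm{in}}:v\in V\}$ of $V$) whose edges are: a clique on $V_{\mathrm{out}}$, a clique on $V_{\mathrm{in}}$, the edges $\{v_{\mathrm{out}},v_{\mathrm{in}}\}$ for $v\in V$, and the edges $\{u_{\mathrm{out}},v_{\mathrm{in}}\}$ for $(u,v)\in E$. Then every vertex cut of $G'$ can be written (possibly after exchanging the roles of its two sides) as $(L',S',R')$ with $L'\subseteq V_{\mathrm{out}}$ and $R'\subseteq V_{\mathrm{in}}$. Moreover, for any vertex cut $(L',S',R')$ of $G'$ with $L'\subseteq V_{\mathrm{out}}$ and $R'\subseteq V_{\mathrm{in}}$, setting $L=\{v\in V:v_{\mathrm{out}}\in L'\}$ and $R=\{v\in V:v_{\mathrm{in}}\in R'\}$, the sets $L$ and $R$ are nonempty and disjoint, and there is no edge $(u,v)\in E$ with $u\in L$ and $v\in R$.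
   Context: A vertex cut of an undirected graph is a tripartition $(L,S,R)$ of its vertex set with $L$ and $R$ nonempty and no edge between a vertex of $L$ and a vertex of $R$; since the graph is undirected, $(R,S,L)$ is then also a vertex cut. -}

module Defs where

open import Data.Nat using (ℕ)
open import Data.Fin using (Fin)
open import Data.Sum using (_⊎_; inj₁; inj₂)
open import Data.Product using (_×_; ∃)
open import Data.Empty using (⊥)
open import Data.Unit using (⊤)
open import Relation.Nullary using (¬_)
open import Relation.Binary.PropositionalEquality using (_≡_; _≢_)

record WDigraph : Set₁ where
  field
    n : ℕ
    E : Fin n → Fin n → Set
    w : Fin n → ℕ

V' : ℕ → Set
V' n = Fin n ⊎ Fin n

out : ∀ {n} → Fin n → V' n
out = inj₁

in' : ∀ {n} → Fin n → V' n
in' = inj₂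

IsOut : ∀ {n} → V' n → Set
IsOut (inj₁ _) = ⊤
IsOut (inj₂ _) = ⊥

IsIn : ∀ {n} → V' n → Set
IsIn (inj₁ _) = ⊥
IsIn (inj₂ _) = ⊤

Adj' : (G : WDigraph) → V' (WDigraph.n G) → V' (WDigraph.n G) → Set
Adj' G (inj₁ u) (inj₁ v) = u ≢ v
Adj' G (inj₂ u) (inj₂ v) = u ≢ v
Adj' G (inj₁ u) (inj₂ v) = (u ≡ v) ⊎ WDigraph.E G u v
Adj' G (inj₂ v) (inj₁ u) = (u ≡ v) ⊎ WDigraph.E G u v

-- A tripartition of a vertex set is a map assigning each vertex to exactly one part.
data Part : Set where
  L S R : Part

record IsVertexCut {V : Set} (Adj : V → V → Set) (part : V → Part) : Set where
  field
    L-nonempty : ∃ λ x → part x ≡ L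
    R-nonempty : ∃ λ x → part x ≡ R
    no-L-R-edge : ∀ x y → Adj x y → part x ≡ L → part y ≡ R → ⊥

_⊆Out : ∀ {n} → (V' n → Set) → Set
P ⊆Out = ∀ x → P x → IsOut x

_⊆In : ∀ {n} → (V' n → Set) → Set
P ⊆In = ∀ x → P x → IsIn x

{-# OPTIONS --safe #-}
-- V_out and V_in are cliques of G' covering all of its vertices, and a clique never meets
-- both sides of a vertex cut: two distinct vertices of it are adjacent. So one side lies in
-- V_out and the other in V_in; the edges v_out v_in and u_out v_in then say exactly that
-- the projected sides are disjoint and not joined by an edge of G.
module Submission where

open import Defs
open import Data.Fin using (Fin; _≟_)
open import Data.Sum using (_⊎_; inj₁; inj₂)
open import Data.Product using (_×_; _,_; ∃)
open import Data.Empty using (⊥; ⊥-elim)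
open import Data.Unit using (tt)
open import Function using (id)
open import Relation.Nullary using (yes; no)
open import Relation.Binary.Definitions using (DecidableEquality)
open import Relation.Binary.PropositionalEquality using (_≡_; _≢_; refl; sym; trans)

L≢R : L ≢ R
L≢R ()

module _ {V : Set} {Adj : V → V → Set} {part : V → Part} (cut : IsVertexCut Adj part) where
  open IsVertexCut cut

  clique-one-sided : {A : Set} → DecidableEquality A → (f : A → V) →
    (∀ {a b} → a ≢ b → Adj (f a) (f b)) →
    ∀ a b → part (f a) ≡ L → part (f b) ≡ R → ⊥
  clique-one-sided _≟ᴬ_ f clique a b pa≡L pb≡R with a ≟ᴬ b
  ... | yes refl = L≢R (trans (sym pa≡L) pb≡R)
  ... | no a≢b   = no-L-R-edge (f a) (f b) (clique a≢b) pa≡L pb≡R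

∃-out : ∀ {n} {P : V' n → Set} → P ⊆Out → ∃ P → ∃ λ v → P (out v)
∃-out P⊆Out (inj₁ v , Pv) = v , Pv
∃-out P⊆Out (inj₂ v , Pv) = ⊥-elim (P⊆Out (in' v) Pv)

∃-in : ∀ {n} {P : V' n → Set} → P ⊆In → ∃ P → ∃ λ v → P (in' v)
∃-in P⊆In (inj₁ v , Pv) = ⊥-elim (P⊆In (out v) Pv)
∃-in P⊆In (inj₂ v , Pv) = v , Pv

module _ (G : WDigraph) (part : V' (WDigraph.n G) → Part) (cut : IsVertexCut (Adj' G) part) where
  open WDigraph G
  open IsVertexCut cut

  out-one-sided : ∀ a b → part (out a) ≡ L → part (out b) ≡ R → ⊥
  out-one-sided = clique-one-sided cut _≟_ out id

  in-one-sided : ∀ a b → part (in' a) ≡ L → part (in' b) ≡ R → ⊥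
  in-one-sided = clique-one-sided cut _≟_ in' id

  sides-in-opposite-cliques :
      ((λ x → part x ≡ L) ⊆Out × (λ x → part x ≡ R) ⊆In)
    ⊎ ((λ x → part x ≡ R) ⊆Out × (λ x → part x ≡ L) ⊆In)
  sides-in-opposite-cliques with L-nonempty | R-nonempty
  ... | inj₁ a , pa≡L | inj₁ b , pb≡R = ⊥-elim (out-one-sided a b pa≡L pb≡R)
  ... | inj₂ a , pa≡L | inj₂ b , pb≡R = ⊥-elim (in-one-sided a b pa≡L pb≡R)
  ... | inj₁ a , pa≡L | inj₂ b , pb≡R = inj₁ (L⊆Out , R⊆In)
    where
    L⊆Out : (λ x → part x ≡ L) ⊆Out
    L⊆Out (inj₁ _) _    = tt
    L⊆Out (inj₂ v) pv≡L = in-one-sided v b pv≡L pb≡R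
    R⊆In : (λ x → part x ≡ R) ⊆In
    R⊆In (inj₁ v) pv≡R = out-one-sided a v pa≡L pv≡R
    R⊆In (inj₂ _) _    = tt
  ... | inj₂ a , pa≡L | inj₁ b , pb≡R = inj₂ (R⊆Out , L⊆In)
    where
    R⊆Out : (λ x → part x ≡ R) ⊆Out
    R⊆Out (inj₁ _) _    = tt
    R⊆Out (inj₂ v) pv≡R = in-one-sided a v pa≡L pv≡R
    L⊆In : (λ x → part x ≡ L) ⊆In
    L⊆In (inj₁ v) pv≡L = out-one-sided v b pv≡L pb≡R
    L⊆In (inj₂ _) _    = tt

  out-in-disjoint : ∀ v → part (out v) ≡ L → part (in' v) ≡ R → ⊥
  out-in-disjoint v = no-L-R-edge (out v) (in' v) (inj₁ refl)

  no-projected-edge : ∀ u v → E u v → part (out u) ≡ L → part (in' v) ≡ R → ⊥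
  no-projected-edge u v uv = no-L-R-edge (out u) (in' v) (inj₂ uv)

proposition3p3 : (G : WDigraph) →
    ((part : V' (WDigraph.n G) → Part) → IsVertexCut (Adj' G) part →
        ((λ x → part x ≡ L) ⊆Out × (λ x → part x ≡ R) ⊆In)
      ⊎ ((λ x → part x ≡ R) ⊆Out × (λ x → part x ≡ L) ⊆In))
    × ((part : V' (WDigraph.n G) → Part) → IsVertexCut (Adj' G) part →
        (λ x → part x ≡ L) ⊆Out → (λ x → part x ≡ R) ⊆In →
          (∃ λ (v : Fin (WDigraph.n G)) → part (out v) ≡ L)
        × (∃ λ (v : Fin (WDigraph.n G)) → part (in' v) ≡ R)
        × (∀ (v : Fin (WDigraph.n G)) → part (out v) ≡ L → part (in' v) ≡ R → ⊥)
        × (∀ (u v : Fin (WDigraph.n G)) → WDigraph.E G u v →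
             part (out u) ≡ L → part (in' v) ≡ R → ⊥))
proposition3p3 G =
    sides-in-opposite-cliques G
  , λ part cut L⊆Out R⊆In →
        ∃-out L⊆Out (IsVertexCut.L-nonempty cut)
      , ∃-in R⊆In (IsVertexCut.R-nonempty cut)
      , out-in-disjoint G part cut
      , no-projected-edge G part cut
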